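{- For all $n\ge1$ and $0\le k\le n$, $R_{k,2n}=\binom{n}{k}^2(n!)^2$.
   Context: $\mathcal{S}_m$ denotes the set of permutations $\sigma=\sigma_1\cdots\sigma_m$ of $\{1,\dots,m\}$. $\overleftarrow{des}_E(\sigma)$ is the number of indices $i\in\{1,\dots,m-1\}$ with $\sigma_i>\sigma_{i+1}$ and $\sigma_i$ even. $R_{k,m}$ denotes the number of $\sigma\in\mathcal{S}_m$ with $\overleftarrow{des}_E(\sigma)=k$. -}

module Defs where

open import Data.Nat using (ℕ; zero; suc; _<ᵇ_; _≡ᵇ_)
open import Data.Nat.DivMod using (_%_)
open import Data.Bool.ListAction using (all; any)
open import Data.Bool using (Bool; true; false; _∧_; if_then_else_)
open import Data.List using (List; []; _∷_; map; concatMap; length; filterᵇ; upTo)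

-- A permutation of {1,…,m} in one-line notation σ₁ ⋯ σₘ is represented
-- as the list [σ₁, …, σₘ] of natural numbers.

words : List ℕ → ℕ → List (List ℕ)
words xs zero = [] ∷ []
words xs (suc n) = concatMap (λ w → map (λ x → x ∷ w) xs) (words xs n)

range : ℕ → List ℕ
range m = map suc (upTo m)

-- w contains each of 1,…,m (together with length m this says w is a
-- permutation of {1,…,m})
containsAll : ℕ → List ℕ → Bool
containsAll m w = all (λ v → any (λ x → v ≡ᵇ x) w) (range m)

perms : ℕ → List (List ℕ)
perms m = filterᵇ (containsAll m) (words (range m) m)

isEven : ℕ → Bool
isEven x = (x % 2) ≡ᵇ 0

desE : List ℕ → ℕ
desE [] = zero
desE (x ∷ []) = zero
desE (x ∷ y ∷ w) =
  (if (y <ᵇ x) ∧ isEven x then suc (desE (y ∷ w)) else desE (y ∷ w))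

R : ℕ → ℕ → ℕ
R k m = length (filterᵇ (λ σ → desE σ ≡ᵇ k) (perms m))

-- Every permutation of a + 1, …, a + j arises exactly once by inserting its minimum a + 1
-- into a permutation u of a + 2, …, a + j.  The minimum never heads a descent, so putting it
-- in front keeps desE u, and putting it right after an entry y raises desE by one exactly
-- when y is even and does not already head a descent.  If u has E even entries and
-- c + E = length u + 1, then c + desE u positions keep desE and E ∸ desE u raise it, so the
-- number of permutations with k even descents obeys R′ k = (c + k) R k + (E ∸ (k − 1)) R (k − 1).
-- Peeling off 1, 2, …, 2n in turn alternates between (c , E) = (i + 1 , i) and (i + 1 , i + 1),
-- and the closed forms C(i,k)² i!² and C(i,k) C(i+1,k) i! (i+1)! satisfy these recurrences
-- by Pascal's rule and (k + 1) C(n+1,k+1) = (n + 1) C(n,k).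
module Submission where

open import Defs
open import Data.Bool using (Bool; true; false; T; not; _∧_)
open import Data.Bool.Properties using (T-≡)
open import Data.Empty using (⊥-elim)
open import Data.List using (List; []; _∷_; _++_; [_]; map; concatMap; length; filterᵇ; upTo; applyUpTo)
open import Data.List.Properties
  using (∷-injective; map-∘; map-cong; length-++; length-map; length-upTo; filter-++; map-applyUpTo)
open import Data.List.Membership.Propositional using (_∈_; _∉_; find; lose)
open import Data.List.Membership.Propositional.Properties
  using (∈-map⁺; ∈-map⁻; ∈-concatMap⁺; ∈-concatMap⁻; ∈-filter⁺; ∈-filter⁻; ∈-∃++)
open import Data.List.Membership.Propositional.Properties.WithK using (unique∧set⇒bag)
open import Data.List.Relation.Binary.BagAndSetEquality using (∼bag⇒↭)
open import Data.List.Relation.Binary.Permutation.Propositional using (_↭_; ↭-refl; ↭-sym; ↭-trans; prep)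
open import Data.List.Relation.Binary.Permutation.Propositional.Properties
  using (shift; drop-mid; ↭-empty-inv; ∈-resp-↭; All-resp-↭; ↭-length; filter-↭)
open import Data.List.Relation.Unary.All as All using (All; []; _∷_)
open import Data.List.Relation.Unary.All.Properties using (all⁺; all⁻)
open import Data.List.Relation.Unary.AllPairs using ([]; _∷_)
open import Data.List.Relation.Unary.Any as Any using (here; there)
open import Data.List.Relation.Unary.Any.Properties using (any⁺; any⁻)
open import Data.List.Relation.Unary.Unique.Propositional using (Unique)
import Data.List.Relation.Unary.Unique.Propositional.Properties as Unique
open import Data.Nat using (ℕ; zero; suc; pred; _+_; _*_; _∸_; _≤_; _<_; _<ᵇ_; _≡ᵇ_; _!)
open import Data.Nat.Properties
open import Data.Nat.Combinatorics using (_C_; nCk+nC[k+1]≡[n+1]C[k+1]; nC1≡n)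
open import Data.Nat.Tactic.RingSolver using (solve-∀; solve)
open import Algebra.Properties.CommutativeSemigroup +-commutativeSemigroup using (x∙yz≈y∙xz; interchange)
open import Data.Product using (_,_; _×_; proj₁; proj₂)
open import Function using (_∋_; _∘_; id; mk⇔; Equivalence)
open import Relation.Binary.PropositionalEquality hiding ([_])
open import Relation.Nullary.Decidable using (T?)

toℕ : Bool → ℕ
toℕ false = 0
toℕ true  = 1

private variable
  A B : Set

countᵇ : (A → Bool) → List A → ℕ
countᵇ p xs = length (filterᵇ p xs)

countᵇ-∷ : ∀ (p : A → Bool) x xs → countᵇ p (x ∷ xs) ≡ toℕ (p x) + countᵇ p xs
countᵇ-∷ p x xs with p x
... | true  = refl
... | false = refl

countᵇ-++ : ∀ (p : A → Bool) xs ys → countᵇ p (xs ++ ys) ≡ countᵇ p xs + countᵇ p ys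
countᵇ-++ p xs ys = trans (cong length (filter-++ (T? ∘ p) xs ys)) (length-++ (filterᵇ p xs))

countᵇ-↭ : ∀ (p : A → Bool) {xs ys} → xs ↭ ys → countᵇ p xs ≡ countᵇ p ys
countᵇ-↭ p xs↭ys = ↭-length (filter-↭ (T? ∘ p) xs↭ys)

countᵇ-false : ∀ (xs : List A) → countᵇ (λ _ → false) xs ≡ 0
countᵇ-false []       = refl
countᵇ-false (_ ∷ xs) = countᵇ-false xs

countᵇ-not+countᵇ : ∀ (p : A → Bool) xs → countᵇ (not ∘ p) xs + countᵇ p xs ≡ length xs
countᵇ-not+countᵇ p []       = refl
countᵇ-not+countᵇ p (x ∷ xs) with p x
... | true  = trans (+-suc _ _) (cong suc (countᵇ-not+countᵇ p xs))
... | false = cong suc (countᵇ-not+countᵇ p xs)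

countᵇ-map : ∀ (p : A → Bool) (f : B → A) xs → countᵇ p (map f xs) ≡ countᵇ (p ∘ f) xs
countᵇ-map p f []       = refl
countᵇ-map p f (x ∷ xs) = begin
  countᵇ p (f x ∷ map f xs)            ≡⟨ countᵇ-∷ p (f x) (map f xs) ⟩
  toℕ (p (f x)) + countᵇ p (map f xs)  ≡⟨ cong (toℕ (p (f x)) +_) (countᵇ-map p f xs) ⟩
  toℕ (p (f x)) + countᵇ (p ∘ f) xs    ≡⟨ countᵇ-∷ (p ∘ f) x xs ⟨
  countᵇ (p ∘ f) (x ∷ xs)              ∎
  where open ≡-Reasoning

⊆∧length⇒↭ : ∀ {xs w : List A} → Unique xs → All (_∈ w) xs → length w ≡ length xs → w ↭ xs
⊆∧length⇒↭ {xs = []} {[]} _ _ _ = ↭-refl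
⊆∧length⇒↭ {xs = x ∷ xs} (x∉xs ∷ xs!) (x∈w ∷ xs⊆w) len with ∈-∃++ x∈w
... | a , b , refl =
  ↭-trans w↭ (prep x (⊆∧length⇒↭ xs! (All.zipWith drop-x (x∉xs , xs⊆w))
                       (suc-injective (trans (sym (↭-length w↭)) len))))
  where
  w↭ : a ++ [ x ] ++ b ↭ x ∷ a ++ b
  w↭ = shift x a b
  drop-x : ∀ {y} → x ≢ y × y ∈ a ++ [ x ] ++ b → y ∈ a ++ b
  drop-x (x≢y , y∈w) with ∈-resp-↭ w↭ y∈w
  ... | here y≡x = ⊥-elim (x≢y (sym y≡x))
  ... | there y∈ab = y∈ab

concatMap-unique : ∀ (f : A → List B) {xs} → Unique xs →
  (∀ {x} → x ∈ xs → Unique (f x)) →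
  (∀ {x y z} → x ∈ xs → y ∈ xs → z ∈ f x → z ∈ f y → x ≡ y) →
  Unique (concatMap f xs)
concatMap-unique f {xs = []} _ _ _ = []
concatMap-unique f {xs = x ∷ xs} (x∉xs ∷ xs!) f! f-disjoint =
  Unique.++⁺ (f! (here refl))
    (concatMap-unique f xs! (f! ∘ there) (λ x∈ y∈ → f-disjoint (there x∈) (there y∈)))
    λ (z∈fx , z∈rest) → let y , y∈xs , z∈fy = find (∈-concatMap⁻ f z∈rest) in
      All.lookup x∉xs y∈xs (f-disjoint (here refl) (there y∈xs) z∈fx z∈fy)

-- Split in two so that the first element of inserts x u is x ∷ u definitionally.
inserts insertsAfterHead : A → List A → List (List A)
inserts x u = (x ∷ u) ∷ insertsAfterHead x u
insertsAfterHead x []       = []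
insertsAfterHead x (y ∷ ys) = map (y ∷_) (inserts x ys)

permutations : List A → List (List A)
permutations []       = [ [] ]
permutations (x ∷ xs) = concatMap (inserts x) (permutations xs)

∈-inserts⁻ : ∀ {x w} (u : List A) → w ∈ inserts x u → w ↭ x ∷ u
∈-inserts⁻ u        (here refl) = ↭-refl
∈-inserts⁻ {x = x} (y ∷ ys) (there w∈) with ∈-map⁻ (y ∷_) w∈
... | w , w∈ins , refl = ↭-trans (prep y (∈-inserts⁻ ys w∈ins)) (shift x [ y ] ys)

∈-inserts⁺ : ∀ {x : A} a b → a ++ x ∷ b ∈ inserts x (a ++ b)
∈-inserts⁺ []      b = here refl
∈-inserts⁺ (y ∷ a) b = there (∈-map⁺ (y ∷_) (∈-inserts⁺ a b))

inserts-injective : ∀ {x w} (u v : List A) → x ∉ u → x ∉ v →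
  w ∈ inserts x u → w ∈ inserts x v → u ≡ v
inserts-injective u v _ _ (here refl) (here refl) = refl
inserts-injective u (y ∷ v) _ x∉v (here refl) (there w∈) with ∈-map⁻ (y ∷_) w∈
... | _ , _ , refl = ⊥-elim (x∉v (here refl))
inserts-injective (y ∷ u) v x∉u _ (there w∈) (here refl) with ∈-map⁻ (y ∷_) w∈
... | _ , _ , refl = ⊥-elim (x∉u (here refl))
inserts-injective (y ∷ u) (y′ ∷ v) x∉u x∉v (there w∈) (there w∈′)
  with ∈-map⁻ (y ∷_) w∈ | ∈-map⁻ (y′ ∷_) w∈′
... | _ , w∈u , refl | _ , w∈v , eq with ∷-injective eq
... | refl , refl = cong (y ∷_) (inserts-injective u v (x∉u ∘ there) (x∉v ∘ there) w∈u w∈v)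

inserts-unique : ∀ {x : A} u → x ∉ u → Unique (inserts x u)
inserts-unique []       _   = [] ∷ []
inserts-unique (y ∷ ys) x∉u =
  All.tabulate (λ v∈ x∷u≡v → let _ , _ , v≡y∷w = ∈-map⁻ (y ∷_) v∈ in
                  x∉u (here (proj₁ (∷-injective (trans x∷u≡v v≡y∷w)))))
  ∷ Unique.map⁺ (proj₂ ∘ ∷-injective) (inserts-unique ys (x∉u ∘ there))

∈-permutations⁻ : ∀ {w} (xs : List A) → w ∈ permutations xs → w ↭ xs
∈-permutations⁻ []       (here refl) = ↭-refl
∈-permutations⁻ (x ∷ xs) w∈ with find (∈-concatMap⁻ (inserts x) w∈)
... | u , u∈ , w∈ins = ↭-trans (∈-inserts⁻ u w∈ins) (prep x (∈-permutations⁻ xs u∈))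

∈-permutations⁺ : ∀ {w} (xs : List A) → w ↭ xs → w ∈ permutations xs
∈-permutations⁺ [] w↭[] rewrite ↭-empty-inv w↭[] = here refl
∈-permutations⁺ (x ∷ xs) w↭ with ∈-∃++ (∈-resp-↭ (↭-sym w↭) (here refl))
... | a , b , refl = ∈-concatMap⁺ (inserts x)
  (lose (∈-permutations⁺ xs (drop-mid a [] w↭)) (∈-inserts⁺ a b))

permutations-unique : ∀ {xs : List A} → Unique xs → Unique (permutations xs)
permutations-unique {xs = []}     _           = [] ∷ []
permutations-unique {xs = x ∷ xs} (x∉xs ∷ xs!) =
  concatMap-unique (inserts x) (permutations-unique xs!)
    (λ {u} u∈ → inserts-unique u (x∉ u∈))
    (λ {u} {v} u∈ v∈ → inserts-injective u v (x∉ u∈) (x∉ v∈))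
  where
  x∉ : ∀ {u} → u ∈ permutations xs → x ∉ u
  x∉ u∈ x∈u = All.lookup x∉xs (∈-resp-↭ (∈-permutations⁻ xs u∈) x∈u) refl

interval : ℕ → ℕ → List ℕ
interval a zero    = []
interval a (suc j) = suc a ∷ interval (suc a) j

interval-above : ∀ a j → All (a <_) (interval a j)
interval-above a zero    = []
interval-above a (suc j) = ≤-refl ∷ All.map (<-trans (n<1+n a)) (interval-above (suc a) j)

interval-unique : ∀ a j → Unique (interval a j)
interval-unique a zero    = []
interval-unique a (suc j) =
  All.map (λ a+1<y a+1≡y → <-irrefl a+1≡y a+1<y) (interval-above (suc a) j) ∷ interval-unique (suc a) j

length-interval : ∀ a j → length (interval a j) ≡ j
length-interval a zero    = refl
length-interval a (suc j) = cong suc (length-interval (suc a) j)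

applyUpTo≡interval : ∀ (f : ℕ → ℕ) a j → (∀ i → f i ≡ suc (a + i)) → applyUpTo f j ≡ interval a j
applyUpTo≡interval f a zero    _ = refl
applyUpTo≡interval f a (suc j) f≗ =
  cong₂ _∷_ (trans (f≗ 0) (cong suc (+-identityʳ a)))
            (applyUpTo≡interval (f ∘ suc) (suc a) j (λ i → trans (f≗ (suc i)) (cong suc (+-suc a i))))

range≡interval : ∀ m → range m ≡ interval 0 m
range≡interval m = trans (map-applyUpTo (λ i → i) suc m) (applyUpTo≡interval suc 0 m (λ _ → refl))

range-unique : ∀ m → Unique (range m)
range-unique m = subst Unique (sym (range≡interval m)) (interval-unique 0 m)

length-range : ∀ m → length (range m) ≡ m
length-range m = trans (length-map suc (upTo m)) (length-upTo m)

∈-words⁻ : ∀ xs n {w} → w ∈ words xs n → length w ≡ n × All (_∈ xs) w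
∈-words⁻ xs zero    (here refl) = refl , []
∈-words⁻ xs (suc n) w∈ with find (∈-concatMap⁻ (λ u → map (_∷ u) xs) {words xs n} w∈)
... | u , u∈ , w∈′ with ∈-map⁻ (_∷ u) w∈′
... | y , y∈xs , refl = let len , u⊆xs = ∈-words⁻ xs n u∈ in cong suc len , y∈xs ∷ u⊆xs

∈-words⁺ : ∀ {xs w} → All (_∈ xs) w → w ∈ words xs (length w)
∈-words⁺ []               = here refl
∈-words⁺ {xs} {y ∷ w} (y∈xs ∷ w⊆xs) =
  ∈-concatMap⁺ (λ u → map (_∷ u) xs) (lose (∈-words⁺ w⊆xs) (∈-map⁺ (_∷ w) y∈xs))

words-unique : ∀ {xs} → Unique xs → ∀ n → Unique (words xs n)
words-unique xs! zero    = [] ∷ []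
words-unique {xs} xs! (suc n) =
  concatMap-unique (λ u → map (_∷ u) xs) (words-unique xs! n)
    (λ _ → Unique.map⁺ (proj₁ ∘ ∷-injective) xs!)
    (λ {u} {v} _ _ z∈ z∈′ → let _ , _ , z≡y∷u = ∈-map⁻ (_∷ u) z∈
                                _ , _ , z≡y′∷v = ∈-map⁻ (_∷ v) z∈′
                            in proj₂ (∷-injective (trans (sym z≡y∷u) z≡y′∷v)))

T-containsAll⁻ : ∀ m {w} → T (containsAll m w) → All (_∈ w) (range m)
T-containsAll⁻ m {w} hit =
  All.map (λ {v} v∈? → Any.map (≡ᵇ⇒≡ v _) (any⁻ _ w v∈?)) (all⁺ _ (range m) hit)

T-containsAll⁺ : ∀ m {w} → All (_∈ w) (range m) → T (containsAll m w)
T-containsAll⁺ m range⊆w = all⁻ _ (All.map (λ {v} v∈w → any⁺ _ (Any.map (≡⇒≡ᵇ v _) v∈w)) range⊆w)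

∈-perms⁻ : ∀ m {w} → w ∈ perms m → w ↭ range m
∈-perms⁻ m w∈ with ∈-filter⁻ (T? ∘ containsAll m) w∈
... | w∈words , hit = ⊆∧length⇒↭ (range-unique m) (T-containsAll⁻ m hit)
                        (trans (proj₁ (∈-words⁻ (range m) m w∈words)) (sym (length-range m)))

∈-perms⁺ : ∀ m {w} → w ↭ range m → w ∈ perms m
∈-perms⁺ m {w} w↭ = ∈-filter⁺ (T? ∘ containsAll m)
  (subst (λ n → w ∈ words (range m) n) (trans (↭-length w↭) (length-range m))
         (∈-words⁺ (All.tabulate (∈-resp-↭ w↭))))
  (T-containsAll⁺ m (All.tabulate (∈-resp-↭ (↭-sym w↭))))

perms↭permutations : ∀ m → perms m ↭ permutations (range m)
perms↭permutations m = ∼bag⇒↭ (unique∧set⇒bag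
  (Unique.filter⁺ _ (words-unique (range-unique m) m))
  (permutations-unique (range-unique m))
  (mk⇔ (∈-permutations⁺ (range m) ∘ ∈-perms⁻ m) (∈-perms⁺ m ∘ ∈-permutations⁻ (range m))))

δ : ℕ → ℕ → ℕ
δ m n = toℕ (m ≡ᵇ n)

δ-subst : ∀ (f : ℕ → ℕ) m n → δ m n * f m ≡ δ m n * f n
δ-subst f m n with m ≡ᵇ n in m≡ᵇn
... | true rewrite ≡ᵇ⇒≡ m n (subst T (sym m≡ᵇn) _) = refl
... | false = refl

<ᵇ-true : ∀ {x y} → x < y → (x <ᵇ y) ≡ true
<ᵇ-true x<y = Equivalence.to T-≡ (<⇒<ᵇ x<y)

<ᵇ-false : ∀ {x y} → x < y → (y <ᵇ x) ≡ false
<ᵇ-false {x} {y} x<y with y <ᵇ x in y<ᵇx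
... | false = refl
... | true  = ⊥-elim (<-asym x<y (<ᵇ⇒< y x (subst T (sym y<ᵇx) _)))

descentAt : ℕ → List ℕ → Bool
descentAt y []      = false
descentAt y (x ∷ _) = (x <ᵇ y) ∧ isEven y

desE-∷ : ∀ y z → desE (y ∷ z) ≡ toℕ (descentAt y z) + desE z
desE-∷ y []      = refl
desE-∷ y (x ∷ z) with (x <ᵇ y) ∧ isEven y
... | true  = refl
... | false = refl

desE-∷-below : ∀ {x} u → All (x <_) u → desE (x ∷ u) ≡ desE u
desE-∷-below []      _         = refl
desE-∷-below {x} (y ∷ u) (x<y ∷ _) =
  trans (desE-∷ x (y ∷ u)) (cong (λ b → toℕ (b ∧ isEven x) + desE (y ∷ u)) (<ᵇ-false x<y))

-- Whether inserting a value below all entries directly after the head y of y ∷ z raises desE.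
gain : ℕ → List ℕ → Bool
gain y z = isEven y ∧ not (descentAt y z)

gains : List ℕ → List Bool
gains []      = []
gains (y ∷ z) = gain y z ∷ gains z

length-gains : ∀ u → length (gains u) ≡ length u
length-gains []      = refl
length-gains (_ ∷ u) = cong suc (length-gains u)

gain+descent : ∀ y z → toℕ (gain y z) + toℕ (descentAt y z) ≡ toℕ (isEven y)
gain+descent y [] with isEven y
... | true  = refl
... | false = refl
gain+descent y (x ∷ _) with x <ᵇ y | isEven y
... | true  | true  = refl
... | true  | false = refl
... | false | true  = refl
... | false | false = refl

gains+desE : ∀ u → countᵇ id (gains u) + desE u ≡ countᵇ isEven u
gains+desE []      = refl
gains+desE (y ∷ z) = begin
  countᵇ id (gain y z ∷ gains z) + desE (y ∷ z)
    ≡⟨ cong₂ _+_ (countᵇ-∷ id (gain y z) (gains z)) (desE-∷ y z) ⟩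
  (toℕ (gain y z) + countᵇ id (gains z)) + (toℕ (descentAt y z) + desE z)
    ≡⟨ interchange (toℕ (gain y z)) _ _ _ ⟩
  (toℕ (gain y z) + toℕ (descentAt y z)) + (countᵇ id (gains z) + desE z)
    ≡⟨ cong₂ _+_ (gain+descent y z) (gains+desE z) ⟩
  toℕ (isEven y) + countᵇ isEven z
    ≡⟨ countᵇ-∷ isEven y z ⟨
  countᵇ isEven (y ∷ z) ∎
  where open ≡-Reasoning

gains≡evens∸desE : ∀ u → countᵇ id (gains u) ≡ countᵇ isEven u ∸ desE u
gains≡evens∸desE u = trans (sym (m+n∸n≡m _ (desE u))) (cong (_∸ desE u) (gains+desE u))

suc-non-gains : ∀ {c} u → c + countᵇ isEven u ≡ suc (length u) → suc (countᵇ not (gains u)) ≡ c + desE u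
suc-non-gains {c} u c+E≡ = +-cancelʳ-≡ G (suc F) (c + desE u) (begin
  suc F + G                 ≡⟨ cong suc (trans (countᵇ-not+countᵇ id (gains u)) (length-gains u)) ⟩
  suc (length u)            ≡⟨ c+E≡ ⟨
  c + countᵇ isEven u       ≡⟨ cong (c +_) (gains+desE u) ⟨
  c + (G + desE u)          ≡⟨ cong (c +_) (+-comm G (desE u)) ⟩
  c + (desE u + G)          ≡⟨ +-assoc c (desE u) G ⟨
  c + desE u + G            ∎)
  where
  open ≡-Reasoning
  F = countᵇ not (gains u)
  G = countᵇ id (gains u)

desE-∷-insertsAfterHead : ∀ x y ys →
  map desE (map (y ∷_) (insertsAfterHead x ys)) ≡ map (toℕ (descentAt y ys) +_) (map desE (insertsAfterHead x ys))
desE-∷-insertsAfterHead x y []        = refl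
desE-∷-insertsAfterHead x y (y′ ∷ ys) = go (inserts x ys)
  where
  go : ∀ ws → map desE (map (y ∷_) (map (y′ ∷_) ws))
            ≡ map (toℕ ((y′ <ᵇ y) ∧ isEven y) +_) (map desE (map (y′ ∷_) ws))
  go []       = refl
  go (w ∷ ws) = cong₂ _∷_ (desE-∷ y (y′ ∷ w)) (go ws)

desE-insertsAfterHead : ∀ {x} u → All (x <_) u →
  map desE (insertsAfterHead x u) ≡ map (λ g → toℕ g + desE u) (gains u)
desE-insertsAfterHead []       []           = refl
desE-insertsAfterHead {x} (y ∷ ys) (x<y ∷ x<ys) = cong₂ _∷_ first rest
  where
  open ≡-Reasoning
  D = descentAt y ys
  first : desE (y ∷ x ∷ ys) ≡ toℕ (gain y ys) + desE (y ∷ ys)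
  first = begin
    desE (y ∷ x ∷ ys)
      ≡⟨ desE-∷ y (x ∷ ys) ⟩
    toℕ ((x <ᵇ y) ∧ isEven y) + desE (x ∷ ys)
      ≡⟨ cong₂ (λ b n → toℕ (b ∧ isEven y) + n) (<ᵇ-true x<y) (desE-∷-below ys x<ys) ⟩
    toℕ (isEven y) + desE ys
      ≡⟨ cong (_+ desE ys) (gain+descent y ys) ⟨
    (toℕ (gain y ys) + toℕ D) + desE ys
      ≡⟨ +-assoc (toℕ (gain y ys)) (toℕ D) (desE ys) ⟩
    toℕ (gain y ys) + (toℕ D + desE ys)
      ≡⟨ cong (toℕ (gain y ys) +_) (desE-∷ y ys) ⟨
    toℕ (gain y ys) + desE (y ∷ ys) ∎
  rest : map desE (map (y ∷_) (insertsAfterHead x ys)) ≡ map (λ g → toℕ g + desE (y ∷ ys)) (gains ys)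
  rest = begin
    map desE (map (y ∷_) (insertsAfterHead x ys))
      ≡⟨ desE-∷-insertsAfterHead x y ys ⟩
    map (toℕ D +_) (map desE (insertsAfterHead x ys))
      ≡⟨ cong (map (toℕ D +_)) (desE-insertsAfterHead ys x<ys) ⟩
    map (toℕ D +_) (map (λ g → toℕ g + desE ys) (gains ys))
      ≡⟨ map-∘ (gains ys) ⟨
    map (λ g → toℕ D + (toℕ g + desE ys)) (gains ys)
      ≡⟨ map-cong (λ g → trans (x∙yz≈y∙xz (toℕ D) (toℕ g) (desE ys)) (cong (toℕ g +_) (sym (desE-∷ y ys)))) (gains ys) ⟩
    map (λ g → toℕ g + desE (y ∷ ys)) (gains ys) ∎

countᵇ-shift : ∀ d k gs →
  countᵇ (λ g → toℕ g + d ≡ᵇ k) gs ≡ δ d k * countᵇ not gs + δ (suc d) k * countᵇ id gs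
countᵇ-shift d k []           = sym (cong₂ _+_ (*-zeroʳ (δ d k)) (*-zeroʳ (δ (suc d) k)))
countᵇ-shift d k (true ∷ gs)  = begin
  countᵇ (λ g → toℕ g + d ≡ᵇ k) (true ∷ gs)
    ≡⟨ countᵇ-∷ (λ g → toℕ g + d ≡ᵇ k) true gs ⟩
  δ (suc d) k + countᵇ (λ g → toℕ g + d ≡ᵇ k) gs
    ≡⟨ cong (δ (suc d) k +_) (countᵇ-shift d k gs) ⟩
  δ (suc d) k + (δ d k * countᵇ not gs + δ (suc d) k * countᵇ id gs)
    ≡⟨ x∙yz≈y∙xz (δ (suc d) k) (δ d k * countᵇ not gs) (δ (suc d) k * countᵇ id gs) ⟩
  δ d k * countᵇ not gs + (δ (suc d) k + δ (suc d) k * countᵇ id gs)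
    ≡⟨ cong (δ d k * countᵇ not gs +_) (*-suc (δ (suc d) k) (countᵇ id gs)) ⟨
  δ d k * countᵇ not gs + δ (suc d) k * suc (countᵇ id gs) ∎
  where open ≡-Reasoning
countᵇ-shift d k (false ∷ gs) = begin
  countᵇ (λ g → toℕ g + d ≡ᵇ k) (false ∷ gs)
    ≡⟨ countᵇ-∷ (λ g → toℕ g + d ≡ᵇ k) false gs ⟩
  δ d k + countᵇ (λ g → toℕ g + d ≡ᵇ k) gs
    ≡⟨ cong (δ d k +_) (countᵇ-shift d k gs) ⟩
  δ d k + (δ d k * countᵇ not gs + δ (suc d) k * countᵇ id gs)
    ≡⟨ +-assoc (δ d k) _ _ ⟨
  (δ d k + δ d k * countᵇ not gs) + δ (suc d) k * countᵇ id gs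
    ≡⟨ cong (_+ δ (suc d) k * countᵇ id gs) (*-suc (δ d k) (countᵇ not gs)) ⟨
  δ d k * suc (countᵇ not gs) + δ (suc d) k * countᵇ id gs ∎
  where open ≡-Reasoning

countDesE : ℕ → List (List ℕ) → ℕ
countDesE k = countᵇ (λ σ → desE σ ≡ᵇ k)

countDesE-inserts : ∀ {x c E} u → All (x <_) u → countᵇ isEven u ≡ E → c + E ≡ suc (length u) → ∀ k →
  countDesE k (inserts x u) ≡ δ (desE u) k * (c + k) + δ (suc (desE u)) k * (E ∸ pred k)
countDesE-inserts {x} {c} {E} u x<u evens≡E c+E≡ k = begin
  countDesE k (inserts x u)
    ≡⟨ countᵇ-map (_≡ᵇ k) desE (inserts x u) ⟨
  countᵇ (_≡ᵇ k) (desE (x ∷ u) ∷ map desE (insertsAfterHead x u))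
    ≡⟨ cong₂ (λ n ns → countᵇ (_≡ᵇ k) (n ∷ ns)) (desE-∷-below u x<u) (desE-insertsAfterHead u x<u) ⟩
  countᵇ (_≡ᵇ k) (d ∷ map (λ g → toℕ g + d) (gains u))
    ≡⟨ countᵇ-∷ (_≡ᵇ k) d _ ⟩
  δ d k + countᵇ (_≡ᵇ k) (map (λ g → toℕ g + d) (gains u))
    ≡⟨ cong (δ d k +_) (trans (countᵇ-map (_≡ᵇ k) _ (gains u)) (countᵇ-shift d k (gains u))) ⟩
  δ d k + (δ d k * countᵇ not (gains u) + δ (suc d) k * countᵇ id (gains u))
    ≡⟨ +-assoc (δ d k) _ _ ⟨
  (δ d k + δ d k * countᵇ not (gains u)) + δ (suc d) k * countᵇ id (gains u)
    ≡⟨ cong (_+ δ (suc d) k * countᵇ id (gains u)) (*-suc (δ d k) (countᵇ not (gains u))) ⟨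
  δ d k * suc (countᵇ not (gains u)) + δ (suc d) k * countᵇ id (gains u)
    ≡⟨ cong₂ (λ a b → δ d k * a + δ (suc d) k * b)
             (suc-non-gains u (trans (cong (c +_) evens≡E) c+E≡))
             (trans (gains≡evens∸desE u) (cong (_∸ d) evens≡E)) ⟩
  δ d k * (c + d) + δ (suc d) k * (E ∸ d)
    ≡⟨ cong₂ _+_ (δ-subst (c +_) d k) (δ-subst (λ m → E ∸ pred m) (suc d) k) ⟩
  δ d k * (c + k) + δ (suc d) k * (E ∸ pred k) ∎
  where
  open ≡-Reasoning
  d = desE u

-- For k = suc k′ the last count is countDesE k′ us by definition; for k = 0 it vanishes.
countDesE-concatMap-inserts : ∀ {x c E v} → All (x <_) v → countᵇ isEven v ≡ E → c + E ≡ suc (length v) →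
  ∀ {us} → All (_↭ v) us → ∀ k →
  countDesE k (concatMap (inserts x) us)
    ≡ (c + k) * countDesE k us + (E ∸ pred k) * countᵇ (λ σ → suc (desE σ) ≡ᵇ k) us
countDesE-concatMap-inserts {c = c} {E} _ _ _ [] k = sym (cong₂ _+_ (*-zeroʳ (c + k)) (*-zeroʳ (E ∸ pred k)))
countDesE-concatMap-inserts {x} {c} {E} {v} x<v evens≡E c+E≡ {u ∷ us} (u↭v ∷ us↭v) k = begin
  countDesE k (inserts x u ++ concatMap (inserts x) us)
    ≡⟨ countᵇ-++ (λ σ → desE σ ≡ᵇ k) (inserts x u) _ ⟩
  countDesE k (inserts x u) + countDesE k (concatMap (inserts x) us)
    ≡⟨ cong₂ _+_ (countDesE-inserts u (All-resp-↭ (↭-sym u↭v) x<v)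
                    (trans (countᵇ-↭ isEven u↭v) evens≡E) (trans c+E≡ (cong suc (sym (↭-length u↭v)))) k)
                 (countDesE-concatMap-inserts x<v evens≡E c+E≡ us↭v k) ⟩
  (δ (desE u) k * (c + k) + δ (suc (desE u)) k * (E ∸ pred k))
    + ((c + k) * countDesE k us + (E ∸ pred k) * countᵇ (λ σ → suc (desE σ) ≡ᵇ k) us)
    ≡⟨ regroup (δ (desE u) k) (δ (suc (desE u)) k) (c + k) (E ∸ pred k) _ _ ⟩
  (c + k) * (δ (desE u) k + countDesE k us)
    + (E ∸ pred k) * (δ (suc (desE u)) k + countᵇ (λ σ → suc (desE σ) ≡ᵇ k) us)
    ≡⟨ cong₂ (λ a b → (c + k) * a + (E ∸ pred k) * b)
             (countᵇ-∷ (λ σ → desE σ ≡ᵇ k) u us) (countᵇ-∷ (λ σ → suc (desE σ) ≡ᵇ k) u us) ⟨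
  (c + k) * countDesE k (u ∷ us) + (E ∸ pred k) * countᵇ (λ σ → suc (desE σ) ≡ᵇ k) (u ∷ us) ∎
  where
  open ≡-Reasoning
  regroup : ∀ a b p q m n → (a * p + b * q) + (p * m + q * n) ≡ p * (a + m) + q * (b + n)
  regroup = solve-∀

countDesE-permutations-∷ : ∀ {x c E} v → All (x <_) v → countᵇ isEven v ≡ E → c + E ≡ suc (length v) → ∀ k →
  countDesE k (permutations (x ∷ v))
    ≡ (c + k) * countDesE k (permutations v) + (E ∸ pred k) * countᵇ (λ σ → suc (desE σ) ≡ᵇ k) (permutations v)
countDesE-permutations-∷ v x<v evens≡E c+E≡ =
  countDesE-concatMap-inserts x<v evens≡E c+E≡ (All.tabulate (∈-permutations⁻ v))

[k+1]*[n+1]C[k+1]≡[n+1]*nCk : ∀ n k → suc k * (suc n C suc k) ≡ suc n * (n C k)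
[k+1]*[n+1]C[k+1]≡[n+1]*nCk zero    zero    = refl
[k+1]*[n+1]C[k+1]≡[n+1]*nCk zero    (suc k) = *-zeroʳ (suc (suc k))
[k+1]*[n+1]C[k+1]≡[n+1]*nCk (suc n) zero    =
  trans (*-identityˡ _) (trans (nC1≡n (suc (suc n))) (sym (*-identityʳ (suc (suc n)))))
[k+1]*[n+1]C[k+1]≡[n+1]*nCk (suc n) (suc k) = begin
  suc (suc k) * (suc (suc n) C suc (suc k))
    ≡⟨ cong (suc (suc k) *_) (nCk+nC[k+1]≡[n+1]C[k+1] (suc n) (suc k)) ⟨
  suc (suc k) * (W + suc n C suc (suc k))
    ≡⟨ *-distribˡ-+ (suc (suc k)) W _ ⟩
  (W + suc k * W) + suc (suc k) * (suc n C suc (suc k))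
    ≡⟨ +-assoc W _ _ ⟩
  W + (suc k * W + suc (suc k) * (suc n C suc (suc k)))
    ≡⟨ cong (W +_) (cong₂ _+_ ([k+1]*[n+1]C[k+1]≡[n+1]*nCk n k) ([k+1]*[n+1]C[k+1]≡[n+1]*nCk n (suc k))) ⟩
  W + (suc n * (n C k) + suc n * (n C suc k))
    ≡⟨ cong (W +_) (*-distribˡ-+ (suc n) (n C k) (n C suc k)) ⟨
  W + suc n * (n C k + n C suc k)
    ≡⟨ cong (λ V → W + suc n * V) (nCk+nC[k+1]≡[n+1]C[k+1] n k) ⟩
  suc (suc n) * W ∎
  where
  open ≡-Reasoning
  W = suc n C suc k

[n∸k]*nCk≡[k+1]*nC[k+1] : ∀ n k → (n ∸ k) * (n C k) ≡ suc k * (n C suc k)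
[n∸k]*nCk≡[k+1]*nC[k+1] n k = begin
  (suc n ∸ suc k) * X                   ≡⟨ *-distribʳ-∸ X (suc n) (suc k) ⟩
  suc n * X ∸ suc k * X                 ≡⟨ cong (_∸ suc k * X) ([k+1]*[n+1]C[k+1]≡[n+1]*nCk n k) ⟨
  suc k * (suc n C suc k) ∸ suc k * X   ≡⟨ cong (λ W → suc k * W ∸ suc k * X) (nCk+nC[k+1]≡[n+1]C[k+1] n k) ⟨
  suc k * (X + Y) ∸ suc k * X           ≡⟨ cong (_∸ suc k * X) (*-distribˡ-+ (suc k) X Y) ⟩
  suc k * X + suc k * Y ∸ suc k * X     ≡⟨ m+n∸m≡n (suc k * X) (suc k * Y) ⟩
  suc k * Y                             ∎
  where
  open ≡-Reasoning
  X = n C k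
  Y = n C suc k

[n+1]*nC[k+1]+[k+1]*[n+1]C[k+1]≡[n+1]*[n+1]C[k+1] : ∀ n k →
  suc n * (n C suc k) + suc k * (suc n C suc k) ≡ suc n * (suc n C suc k)
[n+1]*nC[k+1]+[k+1]*[n+1]C[k+1]≡[n+1]*[n+1]C[k+1] n k = begin
  suc n * (n C suc k) + suc k * (suc n C suc k) ≡⟨ cong (suc n * (n C suc k) +_) ([k+1]*[n+1]C[k+1]≡[n+1]*nCk n k) ⟩
  suc n * (n C suc k) + suc n * (n C k)         ≡⟨ *-distribˡ-+ (suc n) (n C suc k) (n C k) ⟨
  suc n * (n C suc k + n C k)                   ≡⟨ cong (suc n *_) (+-comm (n C suc k) (n C k)) ⟩
  suc n * (n C k + n C suc k)                   ≡⟨ cong (suc n *_) (nCk+nC[k+1]≡[n+1]C[k+1] n k) ⟩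
  suc n * (suc n C suc k)                       ∎
  where open ≡-Reasoning

-- The variable lists carry a type because _∷_ is also the constructor of All.
odd-step-identity : ∀ i k X Y W I t → X + Y ≡ W → t * X ≡ suc k * Y → suc i * Y + suc k * W ≡ suc i * W →
  (suc i + suc k) * ((Y * Y) * (I * I)) + t * ((X * X) * (I * I)) ≡ (Y * W) * (I * (suc i * I))
odd-step-identity i k X Y W I t pascal falling core = begin
  (suc i + suc k) * ((Y * Y) * (I * I)) + t * ((X * X) * (I * I))
    ≡⟨ solve (List ℕ ∋ i ∷ k ∷ X ∷ Y ∷ I ∷ t ∷ []) ⟩
  (suc i + suc k) * ((Y * Y) * (I * I)) + (t * X) * (X * (I * I))
    ≡⟨ cong (λ a → (suc i + suc k) * ((Y * Y) * (I * I)) + a * (X * (I * I))) falling ⟩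
  (suc i + suc k) * ((Y * Y) * (I * I)) + (suc k * Y) * (X * (I * I))
    ≡⟨ solve (List ℕ ∋ i ∷ k ∷ X ∷ Y ∷ I ∷ []) ⟩
  (suc i * Y + suc k * (X + Y)) * (Y * (I * I))
    ≡⟨ cong (λ V → (suc i * Y + suc k * V) * (Y * (I * I))) pascal ⟩
  (suc i * Y + suc k * W) * (Y * (I * I))
    ≡⟨ cong (_* (Y * (I * I))) core ⟩
  (suc i * W) * (Y * (I * I))
    ≡⟨ solve (List ℕ ∋ i ∷ Y ∷ W ∷ I ∷ []) ⟩
  (Y * W) * (I * (suc i * I)) ∎
  where open ≡-Reasoning

even-step-identity : ∀ i k X Y W V I t → X + Y ≡ W → t * V ≡ suc k * W → suc i * Y + suc k * W ≡ suc i * W →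
  (suc i + suc k) * ((Y * W) * (I * (suc i * I))) + t * ((X * V) * (I * (suc i * I)))
    ≡ (W * W) * ((suc i * I) * (suc i * I))
even-step-identity i k X Y W V I t pascal falling core = begin
  (suc i + suc k) * ((Y * W) * (I * (suc i * I))) + t * ((X * V) * (I * (suc i * I)))
    ≡⟨ solve (List ℕ ∋ i ∷ k ∷ X ∷ Y ∷ W ∷ V ∷ I ∷ t ∷ []) ⟩
  (suc i + suc k) * ((Y * W) * (I * (suc i * I))) + (t * V) * (X * (I * (suc i * I)))
    ≡⟨ cong (λ a → (suc i + suc k) * ((Y * W) * (I * (suc i * I))) + a * (X * (I * (suc i * I)))) falling ⟩
  (suc i + suc k) * ((Y * W) * (I * (suc i * I))) + (suc k * W) * (X * (I * (suc i * I)))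
    ≡⟨ solve (List ℕ ∋ i ∷ k ∷ X ∷ Y ∷ W ∷ I ∷ []) ⟩
  (suc i * Y + suc k * (X + Y)) * (W * (I * (suc i * I)))
    ≡⟨ cong (λ U → (suc i * Y + suc k * U) * (W * (I * (suc i * I)))) pascal ⟩
  (suc i * Y + suc k * W) * (W * (I * (suc i * I)))
    ≡⟨ cong (_* (W * (I * (suc i * I)))) core ⟩
  (suc i * W) * (W * (I * (suc i * I)))
    ≡⟨ solve (List ℕ ∋ i ∷ W ∷ I ∷ []) ⟩
  (W * W) * ((suc i * I) * (suc i * I)) ∎
  where open ≡-Reasoning

odd-closed-form-zero : ∀ i I → (suc i + 0) * ((1 * 1) * (I * I)) + i * 0 ≡ (1 * 1) * (I * (suc i * I))
odd-closed-form-zero = solve-∀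

even-closed-form-zero : ∀ i I →
  (suc i + 0) * ((1 * 1) * (I * (suc i * I))) + suc i * 0 ≡ (1 * 1) * ((suc i * I) * (suc i * I))
even-closed-form-zero = solve-∀

odd-closed-form-step : ∀ i k →
  (suc i + suc k) * (((i C suc k) * (i C suc k)) * (i ! * i !)) + (i ∸ k) * (((i C k) * (i C k)) * (i ! * i !))
    ≡ ((i C suc k) * (suc i C suc k)) * (i ! * suc i !)
odd-closed-form-step i k =
  odd-step-identity i k (i C k) (i C suc k) (suc i C suc k) (i !) (i ∸ k) (nCk+nC[k+1]≡[n+1]C[k+1] i k)
    ([n∸k]*nCk≡[k+1]*nC[k+1] i k) ([n+1]*nC[k+1]+[k+1]*[n+1]C[k+1]≡[n+1]*[n+1]C[k+1] i k)

even-closed-form-step : ∀ i k →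
  (suc i + suc k) * (((i C suc k) * (suc i C suc k)) * (i ! * suc i !)) + (suc i ∸ k) * (((i C k) * (suc i C k)) * (i ! * suc i !))
    ≡ ((suc i C suc k) * (suc i C suc k)) * (suc i ! * suc i !)
even-closed-form-step i k =
  even-step-identity i k (i C k) (i C suc k) (suc i C suc k) (suc i C k) (i !) (suc i ∸ k) (nCk+nC[k+1]≡[n+1]C[k+1] i k)
    ([n∸k]*nCk≡[k+1]*nC[k+1] (suc i) k) ([n+1]*nC[k+1]+[k+1]*[n+1]C[k+1]≡[n+1]*[n+1]C[k+1] i k)

double : ℕ → ℕ
double zero    = zero
double (suc n) = suc (suc (double n))

n+n≡double : ∀ n → n + n ≡ double n
n+n≡double zero    = refl
n+n≡double (suc n) = cong suc (trans (+-suc n n) (cong suc (n+n≡double n)))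

isEven-double : ∀ b → isEven (double b) ≡ true
isEven-double zero    = refl
isEven-double (suc b) = isEven-double b

isEven-suc-double : ∀ b → isEven (suc (double b)) ≡ false
isEven-suc-double zero    = refl
isEven-suc-double (suc b) = isEven-suc-double b

evens-even-interval : ∀ b i → countᵇ isEven (interval (double b) (double i)) ≡ i
evens-odd-interval  : ∀ b i → countᵇ isEven (interval (suc (double b)) (suc (double i))) ≡ suc i

evens-even-interval b zero    = refl
evens-even-interval b (suc i) =
  trans (countᵇ-∷ isEven (suc (double b)) _)
        (cong₂ (λ e n → toℕ e + n) (isEven-suc-double b) (evens-odd-interval b i))

evens-odd-interval b i =
  trans (countᵇ-∷ isEven (double (suc b)) _)
        (cong₂ (λ e n → toℕ e + n) (isEven-double (suc b)) (evens-even-interval (suc b) i))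

even-interval-recurrence : ∀ i b k →
  countDesE k (permutations (interval (double b) (double (suc i))))
    ≡ (suc i + k) * countDesE k (permutations (interval (suc (double b)) (suc (double i))))
      + (suc i ∸ pred k) * countᵇ (λ σ → suc (desE σ) ≡ᵇ k) (permutations (interval (suc (double b)) (suc (double i))))
even-interval-recurrence i b =
  countDesE-permutations-∷ (interval (suc (double b)) (suc (double i)))
    (interval-above (suc (double b)) (suc (double i))) (evens-odd-interval b i)
    (cong suc (trans (+-suc i i) (cong suc (trans (n+n≡double i) (sym (length-interval _ (double i)))))))

odd-interval-recurrence : ∀ i b k →
  countDesE k (permutations (interval (suc (double b)) (suc (double i))))
    ≡ (suc i + k) * countDesE k (permutations (interval (double (suc b)) (double i)))
      + (i ∸ pred k) * countᵇ (λ σ → suc (desE σ) ≡ᵇ k) (permutations (interval (double (suc b)) (double i)))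
odd-interval-recurrence i b =
  countDesE-permutations-∷ (interval (double (suc b)) (double i))
    (interval-above (double (suc b)) (double i)) (evens-even-interval (suc b) i)
    (cong suc (trans (n+n≡double i) (sym (length-interval _ (double i)))))

-- The offset b is free because removing the minimum shifts the interval; only its parity matters.
countDesE-even-interval : ∀ i b k →
  countDesE k (permutations (interval (double b) (double i))) ≡ ((i C k) * (i C k)) * (i ! * i !)
countDesE-odd-interval : ∀ i b k →
  countDesE k (permutations (interval (suc (double b)) (suc (double i)))) ≡ ((i C k) * (suc i C k)) * (i ! * suc i !)

countDesE-even-interval zero    b zero    = refl
countDesE-even-interval zero    b (suc k) = refl
countDesE-even-interval (suc i) b zero    =
  trans (even-interval-recurrence i b 0)
    (trans (cong₂ (λ m n → (suc i + 0) * m + suc i * n) (countDesE-odd-interval i b 0)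
                  (countᵇ-false (permutations (interval (suc (double b)) (suc (double i))))))
           (even-closed-form-zero i (i !)))
countDesE-even-interval (suc i) b (suc k) =
  trans (even-interval-recurrence i b (suc k))
    (trans (cong₂ (λ m n → (suc i + suc k) * m + (suc i ∸ k) * n)
                  (countDesE-odd-interval i b (suc k)) (countDesE-odd-interval i b k))
           (even-closed-form-step i k))

countDesE-odd-interval i b zero    =
  trans (odd-interval-recurrence i b 0)
    (trans (cong₂ (λ m n → (suc i + 0) * m + i * n) (countDesE-even-interval i (suc b) 0)
                  (countᵇ-false (permutations (interval (double (suc b)) (double i)))))
           (odd-closed-form-zero i (i !)))
countDesE-odd-interval i b (suc k) =
  trans (odd-interval-recurrence i b (suc k))
    (trans (cong₂ (λ m n → (suc i + suc k) * m + (i ∸ k) * n)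
                  (countDesE-even-interval i (suc b) (suc k)) (countDesE-even-interval i (suc b) k))
           (odd-closed-form-step i k))

theorem3p4 : ∀ (n k : ℕ) → 1 ≤ n → k ≤ n →
    R k (2 * n) ≡ ((n C k) * (n C k)) * ((n !) * (n !))
theorem3p4 n k _ _ = begin
  R k (2 * n)
    ≡⟨ countᵇ-↭ (λ σ → desE σ ≡ᵇ k) (perms↭permutations (2 * n)) ⟩
  countDesE k (permutations (range (2 * n)))
    ≡⟨ cong (countDesE k ∘ permutations) (trans (range≡interval (2 * n)) (cong (interval 0) 2n≡double-n)) ⟩
  countDesE k (permutations (interval (double 0) (double n)))
    ≡⟨ countDesE-even-interval n 0 k ⟩
  ((n C k) * (n C k)) * ((n !) * (n !)) ∎
  where
  open ≡-Reasoning
  2n≡double-n : 2 * n ≡ double n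
  2n≡double-n = trans (cong (n +_) (+-identityʳ n)) (n+n≡double n)
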